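{- $A_3(16,11) \leq 29$.
   Context: For $m \in \mathbb{N}$, $[m] = \{1,\ldots,m\}$. An $(n,d)_q$-code is a set $C \subseteq [q]^n$ in which any two distinct words have Hamming distance at least $d$. $A_q(n,d)$ denotes the maximum size of an $(n,d)_q$-code. -}

module Defs where

open import Data.Nat using (ℕ; zero; suc; _≤_)
open import Data.Fin using (Fin)
open import Data.Fin.Properties using () renaming (_≟_ to _≟F_)
open import Data.Vec using (Vec; []; _∷_)
open import Data.List using (List; length)
open import Data.List.Membership.Propositional using (_∈_)
open import Data.List.Relation.Unary.Unique.Propositional using (Unique)
open import Data.Product using (_×_)
open import Relation.Binary.PropositionalEquality using (_≡_)
open import Relation.Nullary using (¬_; yes; no)

Word : ℕ → ℕ → Set
Word q n = Vec (Fin q) n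

hamming : ∀ {q n} → Word q n → Word q n → ℕ
hamming [] [] = 0
hamming (x ∷ xs) (y ∷ ys) with x ≟F y
... | yes _ = hamming xs ys
... | no  _ = suc (hamming xs ys)

-- An (n,d)_q-code, given as a duplicate-free list of its codewords (so the
-- code's size is the length of the list), in which any two distinct words
-- have Hamming distance at least d.
IsCode : (q n d : ℕ) → List (Word q n) → Set
IsCode q n d C =
  Unique C ×
  (∀ {u v} → u ∈ C → v ∈ C → ¬ (u ≡ v) → d ≤ hamming u v)

A≤ : (q n d m : ℕ) → Set
A≤ q n d m = ∀ (C : List (Word q n)) → IsCode q n d C → length C ≤ m

-- Let K be the words of a ternary (16,11) code with a fixed symbol in a fixed
-- coordinate, N = |K|. Summing distances over ordered pairs of K gives at least
-- 11 N (N - 1). Summing per coordinate instead, a column with symbol counts a, b, c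
-- contributes N^2 - (a^2 + b^2 + c^2) <= N^2 - ceil(N^2/3), and the fixed column
-- contributes nothing; for N = 11 this gives 1210 <= 15 * 80 = 1200, impossible, and
-- for N = 10 it forces every distance in K to be exactly 11.
-- Hence each symbol occurs at most 10 times per coordinate and |C| <= 30; if |C| = 30
-- each occurs exactly 10 times, so a codeword u agrees with the 29 others in
-- 16 * 10 - 16 = 144 coordinates in total. Each of them agrees with u in at most
-- 16 - 11 = 5 coordinates and 5 does not divide 144, so some v agrees with u in
-- between 1 and 4 coordinates: u and v lie in a common such K with N = 10 at
-- distance at least 12, a contradiction.

module Submission where

open import Defs
open import Algebra.Properties.CommutativeSemigroup using (interchange)
open import Data.Bool.Base using (true; false; if_then_else_)
open import Data.Empty using (⊥)
open import Data.Fin.Base using (Fin; zero; suc; punchIn)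
open import Data.Fin.Properties using (_≟_)
open import Data.List.Base using (List; []; _∷_; length; map; filter; take)
open import Data.List.Membership.Propositional using (_∈_)
open import Data.List.Membership.Propositional.Properties using (∈-filter⁺; ∈-filter⁻)
open import Data.List.Properties using (length-take)
open import Data.List.Relation.Binary.Subset.Propositional using (_⊆_)
open import Data.List.Relation.Binary.Subset.Propositional.Properties using (filter-⊆)
import Data.List.Relation.Binary.Sublist.Propositional as Sublist
open import Data.List.Relation.Binary.Sublist.Propositional.Properties using (take-⊆)
import Data.List.Relation.Unary.All as All
open import Data.List.Relation.Unary.AllPairs as AllPairs using (_∷_)
open import Data.List.Relation.Unary.Any using (here; there)
open import Data.List.Relation.Unary.Unique.Propositional using (Unique)
open import Data.List.Relation.Unary.Unique.Propositional.Properties using (take⁺; filter⁺)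
open import Data.Nat.Base using (ℕ; zero; suc; _+_; _*_; _∸_; _≤_; _<_; z≤n; s≤s⁻¹)
open import Data.Nat.Divisibility using (_∣_; _∣?_; _∣0; ∣-refl; ∣m∣n⇒∣m+n)
open import Data.Nat.ListAction using (sum)
open import Data.Nat.Tactic.RingSolver using (solve-∀)
open import Data.Nat.Properties hiding (_≟_)
open import Algebra.Properties.CommutativeMonoid.Sum +-0-commutativeMonoid
  using (sum-syntax; ∑-distrib-+; sum-cong-≗; sum-remove; sum-replicate-zero)
open import Data.Product.Base using (∃-syntax; _×_; _,_; proj₁; proj₂)
open import Data.Sum.Base using (inj₁; inj₂)
open import Data.Vec.Base using ([]; _∷_; lookup)
open import Function.Base using (_∘_)
open import Relation.Binary.PropositionalEquality
open import Relation.Nullary.Decidable using (does; yes; no; from-no; dec-true)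
open import Relation.Nullary.Negation using (¬_; contradiction)

private
  variable
    A : Set
    q n d : ℕ

∑-const : ∀ n m → ∑[ i < n ] m ≡ n * m
∑-const zero    m = refl
∑-const (suc n) m = cong (m +_) (∑-const n m)

∑-mono-≤ : {f g : Fin n → ℕ} → (∀ i → f i ≤ g i) → ∑[ i < n ] f i ≤ ∑[ i < n ] g i
∑-mono-≤ {zero}  f≤g = z≤n
∑-mono-≤ {suc n} f≤g = +-mono-≤ (f≤g zero) (∑-mono-≤ (f≤g ∘ suc))

∑-saturated : ∀ m (f : Fin (suc n) → ℕ) → (∀ i → f i ≤ m) →
                suc n * m ≤ ∑[ i < suc n ] f i → ∀ i → f i ≡ m
∑-saturated {n} m f f≤m n*m≤∑ i = ≤-antisym (f≤m i) (+-cancelʳ-≤ (n * m) m (f i) (begin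
  m + n * m                     ≤⟨ n*m≤∑ ⟩
  ∑[ k < suc n ] f k            ≡⟨ sum-remove {i = i} f ⟩
  f i + ∑[ k < n ] f (punchIn i k) ≤⟨ +-monoʳ-≤ (f i) rest≤ ⟩
  f i + n * m                   ∎))
  where
  open ≤-Reasoning
  rest≤ : ∑[ k < n ] f (punchIn i k) ≤ n * m
  rest≤ = ≤-trans (∑-mono-≤ (f≤m ∘ punchIn i)) (≤-reflexive (∑-const n m))

agree : Fin q → Fin q → ℕ
agree x y = if does (x ≟ y) then 1 else 0

agree-refl : (x : Fin q) → agree x x ≡ 1
agree-refl x rewrite dec-true (x ≟ x) refl = refl

∑-agree : (g : Fin q → ℕ) (x : Fin q) → ∑[ s < q ] (agree s x * g s) ≡ g x
∑-agree {suc q} g zero    =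
  trans (cong₂ _+_ (+-identityʳ (g zero)) (sum-replicate-zero q)) (+-identityʳ (g zero))
∑-agree {suc q} g (suc x) = ∑-agree (g ∘ suc) x

infixl 10 ∑ₗ-syntax

∑ₗ-syntax : List A → (A → ℕ) → ℕ
∑ₗ-syntax L f = sum (map f L)

syntax ∑ₗ-syntax L (λ x → e) = ∑[ x ← L ] e

module _ {f g : A → ℕ} where

  ∑ₗ-cong : ∀ L → (∀ {x} → x ∈ L → f x ≡ g x) → ∑[ x ← L ] f x ≡ ∑[ x ← L ] g x
  ∑ₗ-cong []      f≡g = refl
  ∑ₗ-cong (x ∷ L) f≡g = cong₂ _+_ (f≡g (here refl)) (∑ₗ-cong L (f≡g ∘ there))

  ∑ₗ-mono-≤ : ∀ {L} → (∀ {x} → x ∈ L → f x ≤ g x) → ∑[ x ← L ] f x ≤ ∑[ x ← L ] g x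
  ∑ₗ-mono-≤ {[]}    f≤g = z≤n
  ∑ₗ-mono-≤ {x ∷ L} f≤g = +-mono-≤ (f≤g (here refl)) (∑ₗ-mono-≤ (f≤g ∘ there))

  ∑ₗ-distrib-+ : ∀ L → ∑[ x ← L ] (f x + g x) ≡ ∑[ x ← L ] f x + ∑[ x ← L ] g x
  ∑ₗ-distrib-+ []      = refl
  ∑ₗ-distrib-+ (x ∷ L) = trans (cong (f x + g x +_) (∑ₗ-distrib-+ L))
                               (interchange +-commutativeSemigroup (f x) (g x) _ _)

∑ₗ-const : ∀ (L : List A) m → ∑[ x ← L ] m ≡ length L * m
∑ₗ-const []      m = refl
∑ₗ-const (x ∷ L) m = cong (m +_) (∑ₗ-const L m)

∑ₗ-*-distribʳ : ∀ (f : A → ℕ) L m → ∑[ x ← L ] (f x * m) ≡ ∑[ x ← L ] f x * m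
∑ₗ-*-distribʳ f []      m = refl
∑ₗ-*-distribʳ f (x ∷ L) m =
  trans (cong (f x * m +_) (∑ₗ-*-distribʳ f L m)) (sym (*-distribʳ-+ m (f x) _))

∑ₗ-∑-comm : ∀ (f : A → Fin n → ℕ) L → ∑[ x ← L ] ∑[ i < n ] f x i ≡ ∑[ i < n ] ∑[ x ← L ] f x i
∑ₗ-∑-comm {n = n} f []      = sym (sum-replicate-zero n)
∑ₗ-∑-comm         f (x ∷ L) = trans (cong (∑[ i < _ ] f x i +_) (∑ₗ-∑-comm f L))
                                    (sym (∑-distrib-+ (f x) _))

∈⇒≤∑ₗ : ∀ (f : A → ℕ) {x L} → x ∈ L → f x ≤ ∑[ y ← L ] f y
∈⇒≤∑ₗ f (here refl)  = m≤m+n _ _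
∈⇒≤∑ₗ f (there x∈L) = ≤-trans (∈⇒≤∑ₗ f x∈L) (m≤n+m _ _)

∑ₗ-∤⇒∃ : ∀ {m} (f : A → ℕ) L → ¬ m ∣ ∑[ x ← L ] f x → ∃[ x ] x ∈ L × ¬ m ∣ f x
∑ₗ-∤⇒∃         f []      m∤∑ = contradiction (_ ∣0) m∤∑
∑ₗ-∤⇒∃ {m = m} f (x ∷ L) m∤∑ with m ∣? f x
... | no  m∤fx = x , here refl , m∤fx
... | yes m∣fx with y , y∈L , m∤fy ← ∑ₗ-∤⇒∃ f L (m∤∑ ∘ ∣m∣n⇒∣m+n m∣fx)
  = y , there y∈L , m∤fy

pairSum : (A → A → ℕ) → List A → ℕ
pairSum f L = ∑[ x ← L ] ∑[ y ← L ] f x y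

module _ {f : A → A → ℕ} where

  pairSum-∷ : ∀ x L → pairSum f (x ∷ L) ≡
              f x x + (∑[ y ← L ] f x y + ∑[ y ← L ] f y x) + pairSum f L
  pairSum-∷ x L = begin
    f x x + R + ∑[ y ← L ] (f y x + ∑[ z ← L ] f y z) ≡⟨ cong (f x x + R +_) (∑ₗ-distrib-+ L) ⟩
    f x x + R + (C + pairSum f L)                     ≡⟨ +-assoc (f x x + R) C _ ⟨
    f x x + R + C + pairSum f L                       ≡⟨ cong (_+ pairSum f L) (+-assoc (f x x) R C) ⟩
    f x x + (R + C) + pairSum f L                     ∎
    where
    open ≡-Reasoning
    R C : ℕ
    R = ∑[ y ← L ] f x y
    C = ∑[ y ← L ] f y x

pairSum-mono-≤ : ∀ {f g : A → A → ℕ} c {L} → Unique L →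
                 (∀ {x} → x ∈ L → g x x ≤ c + f x x) →
                 (∀ {x y} → x ∈ L → y ∈ L → x ≢ y → g x y ≤ f x y) →
                 pairSum g L ≤ length L * c + pairSum f L
pairSum-mono-≤ c {[]} _ _ _ = z≤n
pairSum-mono-≤ {f = f} {g} c {x ∷ L} (x∉L ∷ unique) diagonal≤ offDiagonal≤ = begin
  pairSum g (x ∷ L)                                      ≡⟨ pairSum-∷ x L ⟩
  g x x + (Rg + Cg) + pairSum g L                        ≤⟨ +-mono-≤ (+-mono-≤ (diagonal≤ (here refl))
                                                             (+-mono-≤ rows≤ columns≤)) IH ⟩
  c + f x x + (Rf + Cf) + (length L * c + pairSum f L)   ≡⟨ shuffle c (f x x) (Rf + Cf) (length L * c) _ ⟩
  c + length L * c + (f x x + (Rf + Cf) + pairSum f L)   ≡⟨ cong (c + length L * c +_) (pairSum-∷ x L) ⟨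
  (c + length L * c) + pairSum f (x ∷ L)                 ∎
  where
  open ≤-Reasoning
  Rg Cg Rf Cf : ℕ
  Rg = ∑[ y ← L ] g x y
  Cg = ∑[ y ← L ] g y x
  Rf = ∑[ y ← L ] f x y
  Cf = ∑[ y ← L ] f y x
  rows≤ : Rg ≤ Rf
  rows≤ = ∑ₗ-mono-≤ λ y∈L → offDiagonal≤ (here refl) (there y∈L) (All.lookup x∉L y∈L)
  columns≤ : Cg ≤ Cf
  columns≤ = ∑ₗ-mono-≤ λ y∈L → offDiagonal≤ (there y∈L) (here refl) (≢-sym (All.lookup x∉L y∈L))
  IH : pairSum g L ≤ length L * c + pairSum f L
  IH = pairSum-mono-≤ c unique (diagonal≤ ∘ there)
         λ x∈L y∈L → offDiagonal≤ (there x∈L) (there y∈L)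
  shuffle : ∀ a b r k p → a + b + r + (k + p) ≡ a + k + (b + r + p)
  shuffle = solve-∀

module _ {f g : A → A → ℕ} where

  pairSum-cong : ∀ L → (∀ x y → f x y ≡ g x y) → pairSum f L ≡ pairSum g L
  pairSum-cong L f≡g = ∑ₗ-cong L λ _ → ∑ₗ-cong L λ _ → f≡g _ _

  pairSum-distrib-+ : ∀ L → pairSum (λ x y → f x y + g x y) L ≡ pairSum f L + pairSum g L
  pairSum-distrib-+ L = trans (∑ₗ-cong L λ _ → ∑ₗ-distrib-+ L) (∑ₗ-distrib-+ L)

pairSum-const : ∀ (L : List A) m → pairSum (λ _ _ → m) L ≡ length L * (length L * m)
pairSum-const L m = trans (∑ₗ-cong L λ _ → ∑ₗ-const L m) (∑ₗ-const L _)

pairSum-∑-comm : ∀ (f : Fin n → A → A → ℕ) L →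
                 pairSum (λ x y → ∑[ i < n ] f i x y) L ≡ ∑[ i < n ] pairSum (f i) L
pairSum-∑-comm f L = trans (∑ₗ-cong L λ {x} _ → ∑ₗ-∑-comm (λ y i → f i x y) L)
                           (∑ₗ-∑-comm (λ x i → ∑[ y ← L ] f i x y) L)

∈⇒≤pairSum : ∀ (f : A → A → ℕ) {x y L} → x ∈ L → y ∈ L → f x y ≤ pairSum f L
∈⇒≤pairSum f {L = L} x∈L y∈L = ≤-trans (∈⇒≤∑ₗ (f _) y∈L) (∈⇒≤∑ₗ (λ x → ∑[ y ← L ] f x y) x∈L)

module _ (c : A → Fin q) where

  multiplicity : Fin q → List A → ℕ
  multiplicity s L = ∑[ x ← L ] agree s (c x)

  ∑-by-colour : ∀ (g : Fin q → ℕ) L → ∑[ x ← L ] g (c x) ≡ ∑[ s < q ] (multiplicity s L * g s)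
  ∑-by-colour g L = begin
    ∑[ x ← L ] g (c x)                           ≡⟨ ∑ₗ-cong L (λ {x} _ → ∑-agree g (c x)) ⟨
    ∑[ x ← L ] ∑[ s < q ] (agree s (c x) * g s)  ≡⟨ ∑ₗ-∑-comm (λ x s → agree s (c x) * g s) L ⟩
    ∑[ s < q ] ∑[ x ← L ] (agree s (c x) * g s)  ≡⟨ sum-cong-≗ (λ s → ∑ₗ-*-distribʳ (agree s ∘ c) L (g s)) ⟩
    ∑[ s < q ] (multiplicity s L * g s)          ∎
    where open ≡-Reasoning

  ∑-multiplicity : ∀ L → ∑[ s < q ] multiplicity s L ≡ length L
  ∑-multiplicity L = begin
    ∑[ s < q ] multiplicity s L        ≡⟨ sum-cong-≗ (λ s → *-identityʳ (multiplicity s L)) ⟨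
    ∑[ s < q ] (multiplicity s L * 1)  ≡⟨ ∑-by-colour (λ _ → 1) L ⟨
    ∑[ x ← L ] 1                       ≡⟨ ∑ₗ-const L 1 ⟩
    length L * 1                       ≡⟨ *-identityʳ (length L) ⟩
    length L                           ∎
    where open ≡-Reasoning

  agreeingPairs : List A → ℕ
  agreeingPairs = pairSum λ x y → agree (c x) (c y)

  agreeingPairs≡∑-multiplicity² : ∀ L →
                                  agreeingPairs L ≡ ∑[ s < q ] (multiplicity s L * multiplicity s L)
  agreeingPairs≡∑-multiplicity² L = ∑-by-colour (λ s → multiplicity s L) L

  agreeingPairs-monochromatic : ∀ {s} L → (∀ {x} → x ∈ L → s ≡ c x) →
                                agreeingPairs L ≡ length L * length L
  agreeingPairs-monochromatic {s} L monochromatic = begin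
    agreeingPairs L               ≡⟨ ∑ₗ-cong L (λ x∈L → ∑ₗ-cong L λ y∈L → agree-on-L x∈L y∈L) ⟩
    pairSum (λ _ _ → 1) L         ≡⟨ pairSum-const L 1 ⟩
    length L * (length L * 1)     ≡⟨ cong (length L *_) (*-identityʳ (length L)) ⟩
    length L * length L           ∎
    where
    open ≡-Reasoning
    agree-on-L : ∀ {x y} → x ∈ L → y ∈ L → agree (c x) (c y) ≡ 1
    agree-on-L x∈L y∈L =
      trans (cong₂ agree (sym (monochromatic x∈L)) (sym (monochromatic y∈L))) (agree-refl s)

m≤n⇒2*m*n≤m*m+n*n : ∀ {m n} → m ≤ n → 2 * (m * n) ≤ m * m + n * n
m≤n⇒2*m*n≤m*m+n*n {m} m≤n with k , refl ← m≤n⇒∃[o]m+o≡n m≤n =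
  ≤-trans (m≤m+n _ (k * k)) (≤-reflexive (sym (square-gap m k)))
  where
  square-gap : ∀ m k → m * m + (m + k) * (m + k) ≡ 2 * (m * (m + k)) + k * k
  square-gap = solve-∀

2*m*n≤m*m+n*n : ∀ m n → 2 * (m * n) ≤ m * m + n * n
2*m*n≤m*m+n*n m n with ≤-total m n
... | inj₁ m≤n = m≤n⇒2*m*n≤m*m+n*n m≤n
... | inj₂ n≤m = subst₂ _≤_ (cong (2 *_) (*-comm n m)) (+-comm (n * n) (m * m))
                          (m≤n⇒2*m*n≤m*m+n*n n≤m)

[∑]²≤3*∑² : (f : Fin 3 → ℕ) → (∑[ s < 3 ] f s) * (∑[ s < 3 ] f s) ≤ 3 * ∑[ s < 3 ] (f s * f s)
[∑]²≤3*∑² f = begin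
  (a + (b + (c + 0))) * (a + (b + (c + 0)))                  ≡⟨ expand a b c ⟩
  S + (2 * (a * b) + 2 * (b * c) + 2 * (c * a))              ≤⟨ +-monoʳ-≤ S (+-mono-≤ (+-mono-≤
                                                                  (2*m*n≤m*m+n*n a b) (2*m*n≤m*m+n*n b c))
                                                                  (2*m*n≤m*m+n*n c a)) ⟩
  S + ((a * a + b * b) + (b * b + c * c) + (c * c + a * a))  ≡⟨ collect a b c ⟩
  3 * S                                                      ∎
  where
  open ≤-Reasoning
  a b c S : ℕ
  a = f zero
  b = f (suc zero)
  c = f (suc (suc zero))
  S = a * a + (b * b + (c * c + 0))
  expand : ∀ a b c → (a + (b + (c + 0))) * (a + (b + (c + 0))) ≡
                     a * a + (b * b + (c * c + 0)) + (2 * (a * b) + 2 * (b * c) + 2 * (c * a))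
  expand = solve-∀
  collect : ∀ a b c → a * a + (b * b + (c * c + 0))
                        + ((a * a + b * b) + (b * b + c * c) + (c * c + a * a))
                      ≡ 3 * (a * a + (b * b + (c * c + 0)))
  collect = solve-∀

agreeingPairs-ternary : ∀ (c : A → Fin 3) L → length L * length L ≤ 3 * agreeingPairs c L
agreeingPairs-ternary c L = subst₂ (λ N P → N * N ≤ 3 * P)
  (∑-multiplicity c L) (sym (agreeingPairs≡∑-multiplicity² c L)) ([∑]²≤3*∑² λ s → multiplicity c s L)

agreements : Word q n → Word q n → ℕ
agreements {n = n} u v = ∑[ j < n ] agree (lookup u j) (lookup v j)

hamming+agreements : (u v : Word q n) → hamming u v + agreements u v ≡ n
hamming+agreements []       []       = refl
hamming+agreements (x ∷ xs) (y ∷ ys) with x ≟ y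
... | yes _ = trans (+-suc (hamming xs ys) _) (cong suc (hamming+agreements xs ys))
... | no  _ = cong suc (hamming+agreements xs ys)

agreements-refl : (u : Word q n) → agreements u u ≡ n
agreements-refl {n = n} u =
  trans (sum-cong-≗ (agree-refl ∘ lookup u)) (trans (∑-const n 1) (*-identityʳ n))

agreements≢0⇒∃≡ : (u v : Word q n) → agreements u v ≢ 0 → ∃[ j ] lookup u j ≡ lookup v j
agreements≢0⇒∃≡ []       []       ≢0 = contradiction refl ≢0
agreements≢0⇒∃≡ (x ∷ xs) (y ∷ ys) ≢0 with x ≟ y
... | yes x≡y = zero , x≡y
... | no  _ with j , e ← agreements≢0⇒∃≡ xs ys ≢0 = suc j , e

excess : ℕ → List (Word q n) → ℕ
excess d = pairSum λ u v → hamming u v ∸ d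

pairSum-hamming-lower : ∀ {C : List (Word q n)} → IsCode q n d C →
                        length C * (length C * d) + excess d C ≤ length C * d + pairSum hamming C
pairSum-hamming-lower {d = d} {C} (unique , distance) = begin
  length C * (length C * d) + excess d C     ≡⟨ cong (_+ excess d C) (pairSum-const C d) ⟨
  pairSum (λ _ _ → d) C + excess d C         ≡⟨ pairSum-distrib-+ C ⟨
  pairSum (λ u v → d + (hamming u v ∸ d)) C  ≤⟨ pairSum-mono-≤ d unique diagonal offDiagonal ⟩
  length C * d + pairSum hamming C           ∎
  where
  open ≤-Reasoning
  diagonal : ∀ {u} → u ∈ C → d + (hamming u u ∸ d) ≤ d + hamming u u
  diagonal _ = +-monoʳ-≤ d (m∸n≤m _ d)
  offDiagonal : ∀ {u v} → u ∈ C → v ∈ C → u ≢ v → d + (hamming u v ∸ d) ≤ hamming u v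
  offDiagonal u∈C v∈C u≢v = ≤-reflexive (m+[n∸m]≡n (distance u∈C v∈C u≢v))

pairSum-hamming+agreements : (C : List (Word q n)) →
                             pairSum hamming C + pairSum agreements C ≡ length C * (length C * n)
pairSum-hamming+agreements {n = n} C =
  trans (sym (pairSum-distrib-+ C)) (trans (pairSum-cong C hamming+agreements) (pairSum-const C n))

pairSum-agreements : (C : List (Word q n)) →
                     pairSum agreements C ≡ ∑[ j < n ] agreeingPairs (λ w → lookup w j) C
pairSum-agreements C = pairSum-∑-comm (λ j u v → agree (lookup u j) (lookup v j)) C

3*m≤n+2∧n≤3*o⇒m≤o : ∀ {m n o} → 3 * m ≤ n + 2 → n ≤ 3 * o → m ≤ o
3*m≤n+2∧n≤3*o⇒m≤o {m} {n} {o} 3m≤n+2 n≤3o = s≤s⁻¹ (*-cancelˡ-< 3 m (suc o) (begin-strict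
  3 * m          ≤⟨ 3m≤n+2 ⟩
  n + 2          ≤⟨ +-monoˡ-≤ 2 n≤3o ⟩
  3 * o + 2      <⟨ n<1+n _ ⟩
  suc (3 * o + 2) ≡⟨ round-up o ⟩
  3 * suc o      ∎))
  where
  open ≤-Reasoning
  round-up : ∀ o → suc (3 * o + 2) ≡ 3 * suc o
  round-up = solve-∀

-- M stands for ceil(N^2/3), the least number of agreeing ordered pairs in a ternary column.
ternary-shortened-bound : ∀ {C : List (Word 3 (suc n))} → IsCode 3 (suc n) d C →
                          ∀ j {s} → (∀ {w} → w ∈ C → s ≡ lookup w j) →
                          ∀ M → 3 * M ≤ length C * length C + 2 →
                          length C * (length C * d) + excess d C + (length C * length C + n * M)
                            ≤ length C * d + length C * (length C * suc n)
ternary-shortened-bound {n} {d} {C} code j monochromatic M 3M≤N²+2 = begin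
  N * (N * d) + excess d C + (N * N + n * M)  ≤⟨ +-mono-≤ (pairSum-hamming-lower code)
                                                          agreements-lower ⟩
  N * d + H + Ag                              ≡⟨ +-assoc (N * d) H Ag ⟩
  N * d + (H + Ag)                            ≡⟨ cong (N * d +_) (pairSum-hamming+agreements C) ⟩
  N * d + N * (N * suc n)                     ∎
  where
  open ≤-Reasoning
  N H Ag : ℕ
  N = length C
  H = pairSum hamming C
  Ag = pairSum agreements C
  column : Fin (suc n) → ℕ
  column i = agreeingPairs (λ w → lookup w i) C
  M≤column : ∀ i → M ≤ column i
  M≤column i = 3*m≤n+2∧n≤3*o⇒m≤o 3M≤N²+2 (agreeingPairs-ternary (λ w → lookup w i) C)
  column-j : column j ≡ N * N
  column-j = agreeingPairs-monochromatic (λ w → lookup w j) C monochromatic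
  others : n * M ≤ ∑[ k < n ] column (punchIn j k)
  others = ≤-trans (≤-reflexive (sym (∑-const n M))) (∑-mono-≤ (M≤column ∘ punchIn j))
  agreements-lower : N * N + n * M ≤ Ag
  agreements-lower = begin
    N * N + n * M                               ≤⟨ +-monoʳ-≤ (N * N) others ⟩
    N * N + ∑[ k < n ] column (punchIn j k)     ≡⟨ cong (_+ ∑[ k < n ] column (punchIn j k)) column-j ⟨
    column j + ∑[ k < n ] column (punchIn j k)  ≡⟨ sum-remove {i = j} column ⟨
    ∑[ i < suc n ] column i                     ≡⟨ pairSum-agreements C ⟨
    Ag                                          ∎

IsCode-⊆ : ∀ {K C : List (Word q n)} → Unique K → K ⊆ C → IsCode q n d C → IsCode q n d K
IsCode-⊆ unique K⊆C (_ , distance) = unique , λ u∈K v∈K → distance (K⊆C u∈K) (K⊆C v∈K)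

IsCode-take : ∀ k {C : List (Word q n)} → IsCode q n d C → IsCode q n d (take k C)
IsCode-take k {C} code = IsCode-⊆ (take⁺ k (proj₁ code)) (Sublist.lookup (take-⊆ k C)) code

subcode : Fin n → Fin q → List (Word q n) → List (Word q n)
subcode j s = filter λ w → s ≟ lookup w j

module _ (j : Fin n) (s : Fin q) where

  subcode-isCode : ∀ {C} → IsCode q n d C → IsCode q n d (subcode j s C)
  subcode-isCode code = IsCode-⊆ (filter⁺ (λ w → s ≟ lookup w j) (proj₁ code)) (filter-⊆ _ _) code

  ∈-subcode⁺ : ∀ {w C} → w ∈ C → s ≡ lookup w j → w ∈ subcode j s C
  ∈-subcode⁺ = ∈-filter⁺ λ w → s ≟ lookup w j

  ∈-subcode⁻ : ∀ {w C} → w ∈ subcode j s C → s ≡ lookup w j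
  ∈-subcode⁻ {C = C} = proj₂ ∘ ∈-filter⁻ (λ w → s ≟ lookup w j) {xs = C}

  length-subcode : ∀ C → length (subcode j s C) ≡ multiplicity (λ w → lookup w j) s C
  length-subcode []      = refl
  length-subcode (w ∷ C) with does (s ≟ lookup w j)
  ... | true  = cong suc (length-subcode C)
  ... | false = length-subcode C

no-monochromatic-11 : ∀ {K} → IsCode 3 16 11 K → ∀ j {s} → (∀ {w} → w ∈ K → s ≡ lookup w j) →
                      length K ≢ 11
no-monochromatic-11 {K} code j monochromatic |K|≡11 =
  from-no (2067 ≤? 2057) (≤-trans (+-monoˡ-≤ 736 (m≤m+n 1331 (excess 11 K))) bound)
  where
  bound : 1331 + excess 11 K + 736 ≤ 2057
  bound = subst (λ N → N * (N * 11) + excess 11 K + (N * N + 15 * 41) ≤ N * 11 + N * (N * 16)) |K|≡11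
            (ternary-shortened-bound code j monochromatic 41
              (subst (λ N → 123 ≤ N * N + 2) (sym |K|≡11) ≤-refl))

no-monochromatic-10 : ∀ {K u v} → IsCode 3 16 11 K → ∀ j {s} → (∀ {w} → w ∈ K → s ≡ lookup w j) →
                      length K ≡ 10 → u ∈ K → v ∈ K → 12 ≤ hamming u v → ⊥
no-monochromatic-10 {K} code j monochromatic |K|≡10 u∈K v∈K 12≤d =
  from-no (1711 ≤? 1710) (≤-trans (+-monoˡ-≤ 610 (+-monoʳ-≤ 1100 1≤excess)) bound)
  where
  1≤excess : 1 ≤ excess 11 K
  1≤excess = ≤-trans (∸-monoˡ-≤ 11 12≤d) (∈⇒≤pairSum _ u∈K v∈K)
  bound : 1100 + excess 11 K + 610 ≤ 1710
  bound = subst (λ N → N * (N * 11) + excess 11 K + (N * N + 15 * 34) ≤ N * 11 + N * (N * 16)) |K|≡10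
            (ternary-shortened-bound code j monochromatic 34
              (subst (λ N → 102 ≤ N * N + 2) (sym |K|≡10) ≤-refl))

5∤m∧m≤5⇒0<m<5 : ∀ {m} → ¬ 5 ∣ m → m ≤ 5 → 0 < m × m < 5
5∤m∧m≤5⇒0<m<5 5∤m m≤5 =
  n≢0⇒n>0 (λ m≡0 → 5∤m (subst (5 ∣_) (sym m≡0) (5 ∣0))) ,
  ≤∧≢⇒< m≤5 (λ m≡5 → 5∤m (subst (5 ∣_) (sym m≡5) ∣-refl))

module _ {C : List (Word 3 16)} (code : IsCode 3 16 11 C) where

  multiplicity≤10 : ∀ j s → multiplicity (λ w → lookup w j) s C ≤ 10
  multiplicity≤10 j s = ≮⇒≥ λ 10<m →
    no-monochromatic-11 (IsCode-take 11 (subcode-isCode j s code)) j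
      (∈-subcode⁻ j s {C = C} ∘ Sublist.lookup (take-⊆ 11 K))
      (trans (length-take 11 K) (m≤n⇒m⊓n≡m (subst (11 ≤_) (sym (length-subcode j s C)) 10<m)))
    where
    K : List (Word 3 16)
    K = subcode j s C

  module _ (30≤|C| : 30 ≤ length C) where

    multiplicity≡10 : ∀ j s → multiplicity (λ w → lookup w j) s C ≡ 10
    multiplicity≡10 j = ∑-saturated 10 (λ s → multiplicity (λ w → lookup w j) s C) (multiplicity≤10 j)
                          (subst (30 ≤_) (sym (∑-multiplicity (λ w → lookup w j) C)) 30≤|C|)

    ∑-agreements≡160 : ∀ u → ∑[ v ← C ] agreements u v ≡ 160
    ∑-agreements≡160 u = trans (∑ₗ-∑-comm (λ v j → agree (lookup u j) (lookup v j)) C)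
                               (sum-cong-≗ λ j → multiplicity≡10 j (lookup u j))

5∤144 : ¬ 5 ∣ 144
5∤144 = from-no (5 ∣? 144)

∑-agreements-rest≡144 : ∀ {u rest} → IsCode 3 16 11 (u ∷ rest) → 30 ≤ length (u ∷ rest) →
                        ∑[ v ← rest ] agreements u v ≡ 144
∑-agreements-rest≡144 {u} {rest} code 30≤|C| = +-cancelˡ-≡ 16 _ _
  (trans (cong (_+ ∑[ v ← rest ] agreements u v) (sym (agreements-refl u)))
         (∑-agreements≡160 code 30≤|C| u))

agreeing-far-pair : ∀ {C : List (Word q 16)} {u v} → IsCode q 16 11 C → u ∈ C → v ∈ C → u ≢ v →
                    ¬ 5 ∣ agreements u v → (∃[ j ] lookup u j ≡ lookup v j) × 12 ≤ hamming u v
agreeing-far-pair {u = u} {v} (_ , distance) u∈C v∈C u≢v 5∤a =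
  agreements≢0⇒∃≡ u v (≢-sym (<⇒≢ 0<a)) , 12≤d
  where
  a≤5 : agreements u v ≤ 5
  a≤5 = +-cancelˡ-≤ 11 _ _ (subst (11 + agreements u v ≤_) (hamming+agreements u v)
          (+-monoˡ-≤ (agreements u v) (distance u∈C v∈C u≢v)))
  0<a : 0 < agreements u v
  0<a = proj₁ (5∤m∧m≤5⇒0<m<5 5∤a a≤5)
  12≤d : 12 ≤ hamming u v
  12≤d = +-cancelʳ-≤ (agreements u v) 12 _
           (subst (12 + agreements u v ≤_) (sym (hamming+agreements u v))
                  (+-monoʳ-≤ 11 (proj₂ (5∤m∧m≤5⇒0<m<5 5∤a a≤5))))

proposition16 : A≤ 3 16 11 29
proposition16 []           _    = z≤n
proposition16 C@(u ∷ rest) code = ≮⇒≥ λ 29<|C| →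
  let v , v∈rest , 5∤a = ∑ₗ-∤⇒∃ (agreements u) rest
                           (subst (λ m → ¬ 5 ∣ m) (sym (∑-agreements-rest≡144 code 29<|C|)) 5∤144)
      (j , uj≡vj) , 12≤d = agreeing-far-pair code (here refl) (there v∈rest)
                             (All.lookup (AllPairs.head (proj₁ code)) v∈rest) 5∤a
      s = lookup u j
  in no-monochromatic-10 (subcode-isCode j s code) j (∈-subcode⁻ j s {C = C})
       (trans (length-subcode j s C) (multiplicity≡10 code 29<|C| j s))
       (∈-subcode⁺ j s (here refl) refl) (∈-subcode⁺ j s (there v∈rest) uj≡vj) 12≤d
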